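{- Fix an integer $g \ge 0$. Let $\mathcal{S}_2$ be the set of strongly descended numerical semigroups $\Lambda$ with $h(\Lambda) + g(\Lambda) \ge g$ and $g(\Lambda) - h(\Lambda) < \frac{g}{3}$, and let $n_{g,2} = \sum_{\Lambda \in \mathcal{S}_2} N_g(\Lambda)$. Let $t_g$ be the number of numerical semigroups $\Lambda$ of genus $g$ with $f(\Lambda) < 3m(\Lambda)$. Then $n_{g,2} \le t_g$.
   Context: A numerical semigroup is a subset $\Lambda \subseteq \mathbb{N}$ containing $0$, closed under addition, with finite complement. Genus $g(\Lambda) = |\mathbb{N}\setminus\Lambda|$; multiplicity $m(\Lambda)=\min(\Lambda\setminus\{0\})$; Frobenius number $f(\Lambda)=\max(\mathbb{N}\setminus\Lambda)$ (with $f(\mathbb{N})=-1$). A minimal generator is a nonzero element of $\Lambda$ not a sum of two nonzero elements of $\Lambda$; an effective generator is a minimal generator larger than $f(\Lambda)$; $h(\Lambda)$ is the number of effective generators. $\Lambda'$ descends from $\Lambda$ if $\Lambda' = \Lambda\setminus\{\lambda\}$ for an effective generator $\lambda$ of $\Lambda$; the descent is weak if every effective generator of $\Lambda'$ is an effective generator of $\Lambda$, and strong otherwise. $\Lambda'$ is strongly descended if it is obtained from some numerical semigroup by a strong descent; by convention $\mathbb{N}$ is also strongly descended. $\Lambda''$ is a weak descendent of $\Lambda$ if obtained from $\Lambda$ by a finite (possibly empty) sequence of weak descents; $N_g(\Lambda)$ is the number of weak descendents of $\Lambda$ of genus $g$. -}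

module Defs where

open import Data.Nat using (ℕ; zero; suc; _+_; _*_; _<_; _≤_; _≥_)
open import Data.Integer as ℤ using (ℤ; +_; -[1+_]; _⊔_)
open import Data.List using (List; []; _∷_; length; foldr)
open import Data.List.Membership.Propositional using (_∈_; _∉_)
open import Data.List.Relation.Unary.Linked using (Linked)
open import Data.List.Relation.Unary.Unique.Propositional using (Unique)
open import Data.Product using (Σ; ∃; ∃-syntax; _×_; _,_)
open import Data.Sum using (_⊎_)
open import Relation.Nullary using (¬_)
open import Relation.Binary.PropositionalEquality using (_≡_; _≢_)
open import Relation.Binary.Construct.Closure.ReflexiveTransitive using (Star)
open import Function.Bundles using (_⇔_)

-- A numerical semigroup Λ is represented (canonically) by its list of gaps
-- ℕ ∖ Λ, listed in strictly increasing order.  Finiteness of the complement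
-- is thus built in.
Gaps : Set
Gaps = List ℕ

_∈Λ_ : ℕ → Gaps → Set
n ∈Λ G = n ∉ G

IsNumSemigroup : Gaps → Set
IsNumSemigroup G =
  Linked _<_ G
  × (0 ∈Λ G)
  × (∀ a b → a ∈Λ G → b ∈Λ G → (a + b) ∈Λ G)

genus : Gaps → ℕ
genus G = length G

-- Frobenius number: largest gap, -1 for ℕ (no gaps)
frob : Gaps → ℤ
frob G = foldr (λ x r → (+ x) ⊔ r) -[1+ 0 ] G

IsMultiplicity : Gaps → ℕ → Set
IsMultiplicity G m = (0 < m) × (m ∈Λ G) × (∀ k → 0 < k → k ∈Λ G → m ≤ k)

IsMinimalGenerator : Gaps → ℕ → Set
IsMinimalGenerator G x =
  (x ∈Λ G) × (0 < x) ×
  ¬ (Σ ℕ λ a → Σ ℕ λ b → (0 < a) × (0 < b) × (a ∈Λ G) × (b ∈Λ G) × (a + b ≡ x))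

IsEffectiveGenerator : Gaps → ℕ → Set
IsEffectiveGenerator G x = IsMinimalGenerator G x × (frob G ℤ.< + x)

-- "n is the number of elements of type A satisfying P":
-- a duplicate-free list of length n containing exactly the elements satisfying P.
IsCount : {A : Set} → (A → Set) → ℕ → Set
IsCount {A} P n =
  Σ (List A) λ L → Unique L × (∀ x → (x ∈ L) ⇔ P x) × (length L ≡ n)

IsH : Gaps → ℕ → Set
IsH G n = IsCount (IsEffectiveGenerator G) n

Descends : Gaps → Gaps → Set
Descends G' G =
  IsNumSemigroup G × IsNumSemigroup G' ×
  Σ ℕ λ l → IsEffectiveGenerator G l ×
    (∀ n → (n ∈Λ G') ⇔ ((n ∈Λ G) × (n ≢ l)))

WeakDescent : Gaps → Gaps → Set
WeakDescent G' G =
  Descends G' G × (∀ x → IsEffectiveGenerator G' x → IsEffectiveGenerator G x)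

StrongDescent : Gaps → Gaps → Set
StrongDescent G' G =
  Descends G' G × ¬ (∀ x → IsEffectiveGenerator G' x → IsEffectiveGenerator G x)

-- strongly descended (ℕ, i.e. the empty gap list, by convention)
StronglyDescended : Gaps → Set
StronglyDescended G = (G ≡ []) ⊎ (Σ Gaps λ G₀ → StrongDescent G G₀)

-- Λ'' is a weak descendent of Λ: finite (possibly empty) chain of weak descents
-- Star R x y : chain x R … R y ;  here WeakDescendent Λ'' Λ
WeakDescendent : Gaps → Gaps → Set
WeakDescendent G'' G = Star (λ X Y → WeakDescent Y X) G G''

-- membership in 𝒮₂ (for the fixed g):
-- h(Λ) + g(Λ) ≥ g  and  g(Λ) - h(Λ) < g/3  (i.e. 3 g(Λ) < g + 3 h(Λ))
InS₂ : ℕ → Gaps → Set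
InS₂ g G =
  IsNumSemigroup G × StronglyDescended G ×
  Σ ℕ λ h → IsH G h × (h + genus G ≥ g) × (3 * genus G < g + 3 * h)

-- pairs (Λ, Λ'') with Λ ∈ 𝒮₂ and Λ'' a weak descendent of Λ of genus g;
-- their number is n_{g,2} = Σ_{Λ ∈ 𝒮₂} N_g(Λ)
S₂Pair : ℕ → Gaps × Gaps → Set
S₂Pair g (G , G'') = InS₂ g G × WeakDescendent G'' G × (genus G'' ≡ g)

TSemigroup : ℕ → Gaps → Set
TSemigroup g G =
  IsNumSemigroup G × (genus G ≡ g) ×
  Σ ℕ λ m → IsMultiplicity G m × (frob G ℤ.< + (3 * m))

-- Send each pair (Λ, Λ'') to Λ''.  The map is injective because a numerical semigroup has at most
-- one parent in the descent tree, so walking up weak descents from Λ'' reaches at most one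
-- strongly descended semigroup.  It lands among the semigroups counted by t_g: every gap of a
-- weak descendent Λ'' of Λ is a gap or an effective generator of Λ, so g ≤ g(Λ) + h(Λ).  If Λ had
-- a gap F ≥ 2m, then x ↦ x - m and x ↦ x - 2m would send the h effective generators (all > F)
-- injectively and with disjoint images into the gaps, so 2h ≤ g(Λ), which together with
-- g ≤ g(Λ) + h contradicts 3 g(Λ) < g + 3h.  Hence the gaps of Λ lie below 2m, its effective
-- generators below 3m, and so do all gaps of Λ'', whose multiplicity is at least m.
module Submission where

open import Defs
open import Data.Nat using (ℕ; zero; suc; _+_; _*_; _∸_; _<_; _≤_; _<?_; _≤?_; _≟_; z≤n; s≤s)
open import Data.Nat.Properties
open import Data.Nat.Solver using (module +-*-Solver)
open import Data.Integer as ℤ using (+<+; -<+)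
import Data.Integer.Properties as ℤ
open import Data.List using (List; []; _∷_; length; _++_; map)
open import Data.List.Properties using (length-++; length-map)
open import Data.List.Extrema.Nat using (max; xs≤max)
open import Data.List.Membership.Propositional using (_∈_; _∉_)
open import Data.List.Membership.DecPropositional _≟_ using (_∈?_)
open import Data.List.Membership.Propositional.Properties using (∈-map⁻; ∈-++⁺ˡ; ∈-++⁺ʳ; ∈-++⁻)
open import Data.List.Relation.Binary.Subset.Propositional using (_⊆_)
open import Data.List.Relation.Unary.Any using (here; there)
open import Data.List.Relation.Unary.All as All using (All)
open import Data.List.Relation.Unary.AllPairs as AllPairs using (AllPairs; []; _∷_)
open import Data.List.Relation.Unary.Linked using (Linked)
open import Data.List.Relation.Unary.Linked.Properties using (Linked⇒AllPairs)
open import Data.List.Relation.Unary.Unique.Propositional using (Unique)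
import Data.List.Relation.Unary.Unique.Propositional.Properties as Unique
open import Data.Product using (Σ; _×_; _,_; proj₁; proj₂)
open import Data.Sum using (_⊎_; inj₁; inj₂)
open import Data.Empty using (⊥-elim)
open import Function using (id; _∘_)
open import Function.Bundles using (_⇔_; Equivalence)
open import Relation.Nullary using (¬_; yes; no)
open import Relation.Nullary.Decidable using (_×-dec_; ¬?)
open import Relation.Unary using (Decidable)
open import Relation.Binary.PropositionalEquality
open import Relation.Binary.Construct.Closure.ReflexiveTransitive as Star using (Star; ε; _◅_)

open Equivalence using (to; from)

module _ {A : Set} where

  remove : {x : A} (ys : List A) → x ∈ ys → List A
  remove (_ ∷ ys) (here _)  = ys
  remove (y ∷ ys) (there p) = y ∷ remove ys p

  length-remove : {x : A} (ys : List A) (p : x ∈ ys) → length ys ≡ suc (length (remove ys p))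
  length-remove (_ ∷ ys) (here _)  = refl
  length-remove (y ∷ ys) (there p) = cong suc (length-remove ys p)

  ∈-remove : {x z : A} (ys : List A) (p : x ∈ ys) → z ∈ ys → z ≢ x → z ∈ remove ys p
  ∈-remove (_ ∷ ys) (here refl) (here refl) z≢x = ⊥-elim (z≢x refl)
  ∈-remove (_ ∷ ys) (here refl) (there q)   _   = q
  ∈-remove (y ∷ ys) (there p)   (here eq)   _   = here eq
  ∈-remove (y ∷ ys) (there p)   (there q)   z≢x = there (∈-remove ys p q z≢x)

module _ {A B : Set} where

  injectiveOn⇒length≤ : (f : A → B) {xs : List A} {ys : List B} → Unique xs →
                        (∀ {x y} → x ∈ xs → y ∈ xs → f x ≡ f y → x ≡ y) →
                        (∀ {x} → x ∈ xs → f x ∈ ys) → length xs ≤ length ys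
  injectiveOn⇒length≤ f {[]}     _              _   _  = z≤n
  injectiveOn⇒length≤ f {x ∷ xs} {ys} (x∉xs ∷ u) inj fx∈ =
    subst (suc (length xs) ≤_) (sym (length-remove ys fx∈ys))
      (s≤s (injectiveOn⇒length≤ f u (λ p q → inj (there p) (there q)) fy∈rest))
    where
    fx∈ys : f x ∈ ys
    fx∈ys = fx∈ (here refl)
    fy∈rest : ∀ {y} → y ∈ xs → f y ∈ remove ys fx∈ys
    fy∈rest {y} y∈xs = ∈-remove ys fx∈ys (fx∈ (there y∈xs))
      (λ fy≡fx → All.lookup x∉xs y∈xs (sym (inj (there y∈xs) (here refl) fy≡fx)))

strictlyIncreasing⇒unique : ∀ {xs} → Linked _<_ xs → Unique xs
strictlyIncreasing⇒unique = AllPairs.map <⇒≢ ∘ Linked⇒AllPairs <-trans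

least≤member : ∀ {x xs z} → All (x <_) xs → z ∈ x ∷ xs → x ≤ z
least≤member _  (here refl) = ≤-refl
least≤member x< (there z∈)  = <⇒≤ (All.lookup x< z∈)

∷-⊆-∷⁻ : ∀ {x xs ys} → All (x <_) xs → x ∷ xs ⊆ x ∷ ys → xs ⊆ ys
∷-⊆-∷⁻ x<xs xs⊆ys z∈ with xs⊆ys (there z∈)
... | here refl = ⊥-elim (<-irrefl refl (All.lookup x<xs z∈))
... | there z∈′ = z∈′

strictlyIncreasing-⊆-antisym : ∀ {xs ys} → AllPairs _<_ xs → AllPairs _<_ ys →
                               xs ⊆ ys → ys ⊆ xs → xs ≡ ys
strictlyIncreasing-⊆-antisym []        []        _     _     = refl
strictlyIncreasing-⊆-antisym []        (_ ∷ _)   _     ys⊆xs with () ← ys⊆xs (here refl)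
strictlyIncreasing-⊆-antisym (_ ∷ _)   []        xs⊆ys _     with () ← xs⊆ys (here refl)
strictlyIncreasing-⊆-antisym {x ∷ _} (x< ∷ sxs) (y< ∷ sys) xs⊆ys ys⊆xs
  with refl ← ≤-antisym (least≤member x< (ys⊆xs (here refl))) (least≤member y< (xs⊆ys (here refl))) =
  cong (x ∷_) (strictlyIncreasing-⊆-antisym sxs sys (∷-⊆-∷⁻ x< xs⊆ys) (∷-⊆-∷⁻ y< ys⊆xs))

least : {P : ℕ → Set} → Decidable P → ∀ {b} → P b →
        Σ ℕ λ k → P k × (∀ j → j < k → ¬ P j)
least P? {zero} p  = 0 , p , λ _ ()
least P? {suc b} p with P? 0
... | yes p0 = 0 , p0 , λ _ ()
... | no ¬p0 with k , pk , below ← least (P? ∘ suc) {b} p =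
  suc k , pk , λ { zero _ → ¬p0 ; (suc j) (s≤s j<k) → below j j<k }

gap≤frob : ∀ {a} (G : Gaps) → a ∈ G → ℤ.+ a ℤ.≤ frob G
gap≤frob (x ∷ G) (here refl) = ℤ.i≤i⊔j (ℤ.+ x) (frob G)
gap≤frob (x ∷ G) (there a∈G) = ℤ.i≤j⇒i≤k⊔j (ℤ.+ x) (gap≤frob G a∈G)

frob<-gaps< : ∀ (G : Gaps) {b} → (∀ {a} → a ∈ G → a < b) → frob G ℤ.< ℤ.+ b
frob<-gaps< []      _     = -<+
frob<-gaps< (x ∷ G) gaps< with ℤ.⊔-sel (ℤ.+ x) (frob G)
... | inj₁ eq rewrite eq = +<+ (gaps< (here refl))
... | inj₂ eq rewrite eq = frob<-gaps< G (gaps< ∘ there)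

1+max∉ : (G : Gaps) → suc (max 0 G) ∉ G
1+max∉ G q = <-irrefl refl (s≤s (All.lookup (xs≤max 0 G) q))

multiplicity : (G : Gaps) → Σ ℕ (IsMultiplicity G)
multiplicity G
  with k , (0<k , k∉G) , below ← least (λ k → (0 <? k) ×-dec ¬? (k ∈? G)) (s≤s z≤n , 1+max∉ G)
  = k , 0<k , k∉G , λ j 0<j j∉G → ≮⇒≥ (λ j<k → below j j<k (0<j , j∉G))

gap<effective : ∀ {G x a} → IsEffectiveGenerator G x → a ∈ G → a < x
gap<effective {G} (_ , frob<x) a∈G = ℤ.drop‿+<+ (ℤ.≤-<-trans (gap≤frob G a∈G) frob<x)

minimal∸member∈gaps : ∀ {G x a} → IsMinimalGenerator G x → 0 < a → a ∈Λ G → a < x → x ∸ a ∈ G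
minimal∸member∈gaps {G} {x} {a} (_ , _ , notSum) 0<a a∈Λ a<x with (x ∸ a) ∈? G
... | yes x∸a∈G = x∸a∈G
... | no  x∸a∉G = ⊥-elim (notSum (a , x ∸ a , 0<a , m<n⇒0<n∸m a<x , a∈Λ , x∸a∉G , m+[n∸m]≡n (<⇒≤ a<x)))

minimal<multiplicity+gapBound : ∀ {G m c x} → IsMultiplicity G m → 0 < c → (∀ {a} → a ∈ G → a < c) →
                                IsMinimalGenerator G x → x < m + c
minimal<multiplicity+gapBound {m = m} {c} {x} (0<m , m∈Λ , _) 0<c gaps<c minimal with x ≤? m
... | yes x≤m = ≤-<-trans x≤m (m<m+n m 0<c)
... | no  x≰m = begin-strict
  x             ≡⟨ m+[n∸m]≡n (<⇒≤ m<x) ⟨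
  m + (x ∸ m)   <⟨ +-monoʳ-< m (gaps<c (minimal∸member∈gaps minimal 0<m m∈Λ m<x)) ⟩
  m + c         ∎
  where
  open ≤-Reasoning
  m<x : m < x
  m<x = ≰⇒> x≰m

-- The two maps x ↦ x - m and x ↦ x - 2m on the effective generators E are realised as the single
-- map v ↦ v - 2m on E ++ (m + E).
twice-h≤genus : ∀ {G m h F} → IsNumSemigroup G → IsMultiplicity G m → IsH G h →
                F ∈ G → m + m ≤ F → h + h ≤ genus G
twice-h≤genus {G} {m} (_ , _ , closed) (0<m , m∈Λ , _) (E , uniqueE , E⇔eff , refl) F∈G 2m≤F =
  subst (_≤ genus G) (trans (length-++ E) (cong (length E +_) (length-map (m +_) E)))
    (injectiveOn⇒length≤ (_∸ (m + m)) unique injective into-gaps)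
  where
  effective : ∀ {x} → x ∈ E → IsEffectiveGenerator G x
  effective {x} = to (E⇔eff x)
  2m<eff : ∀ {x} → x ∈ E → m + m < x
  2m<eff x∈E = ≤-<-trans 2m≤F (gap<effective (effective x∈E) F∈G)
  m<eff : ∀ {x} → x ∈ E → m < x
  m<eff x∈E = ≤-<-trans (m≤m+n m m) (2m<eff x∈E)
  disjoint : ∀ {v} → ¬ (v ∈ E × v ∈ map (m +_) E)
  disjoint (v∈E , v∈m+E) with y , y∈E , refl ← ∈-map⁻ (m +_) v∈m+E =
    proj₂ (proj₂ (proj₁ (effective v∈E)))
      (m , y , 0<m , <-trans 0<m (m<eff y∈E) , m∈Λ , proj₁ (proj₁ (effective y∈E)) , refl)
  unique : Unique (E ++ map (m +_) E)
  unique = Unique.++⁺ uniqueE (Unique.map⁺ (+-cancelˡ-≡ m _ _) uniqueE) disjoint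
  above2m : ∀ {v} → v ∈ E ++ map (m +_) E → m + m ≤ v
  above2m v∈ with ∈-++⁻ E v∈
  ... | inj₁ v∈E = <⇒≤ (2m<eff v∈E)
  ... | inj₂ v∈m+E with y , y∈E , refl ← ∈-map⁻ (m +_) v∈m+E = +-monoʳ-≤ m (<⇒≤ (m<eff y∈E))
  injective : ∀ {u v} → u ∈ E ++ map (m +_) E → v ∈ E ++ map (m +_) E →
              u ∸ (m + m) ≡ v ∸ (m + m) → u ≡ v
  injective u∈ v∈ = ∸-cancelʳ-≡ (above2m u∈) (above2m v∈)
  into-gaps : ∀ {v} → v ∈ E ++ map (m +_) E → v ∸ (m + m) ∈ G
  into-gaps v∈ with ∈-++⁻ E v∈
  ... | inj₁ v∈E = minimal∸member∈gaps (proj₁ (effective v∈E))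
                     (<-≤-trans 0<m (m≤m+n m m)) (closed m m m∈Λ m∈Λ) (2m<eff v∈E)
  ... | inj₂ v∈m+E with y , y∈E , refl ← ∈-map⁻ (m +_) v∈m+E =
    subst (_∈ G) (sym ([m+n]∸[m+o]≡n∸o m y m))
      (minimal∸member∈gaps (proj₁ (effective y∈E)) 0<m m∈Λ (m<eff y∈E))

Removal : Gaps → Gaps → ℕ → Set
Removal G′ G l = ∀ n → (n ∈Λ G′) ⇔ ((n ∈Λ G) × (n ≢ l))

module _ {G′ G l} (removal : Removal G′ G l) where

  removal-gaps⊆ : G ⊆ G′
  removal-gaps⊆ {n} n∈G with n ∈? G′
  ... | yes n∈G′ = n∈G′
  ... | no  n∉G′ = ⊥-elim (proj₁ (to (removal n) n∉G′) n∈G)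

  removal-removed∈gaps : l ∈ G′
  removal-removed∈gaps with l ∈? G′
  ... | yes l∈G′ = l∈G′
  ... | no  l∉G′ = ⊥-elim (proj₂ (to (removal l) l∉G′) refl)

  removal-gap : ∀ {n} → n ∈ G′ → n ≢ l → n ∈ G
  removal-gap {n} n∈G′ n≢l with n ∈? G
  ... | yes n∈G = n∈G
  ... | no  n∉G = ⊥-elim (from (removal n) (n∉G , n≢l) n∈G′)

-- Each removed element is a gap of the other parent, hence below that parent's removed generator.
removal-generator-unique : ∀ {G′ G H l k} → Removal G′ G l → IsEffectiveGenerator G l →
                           Removal G′ H k → IsEffectiveGenerator H k → l ≡ k
removal-generator-unique {l = l} {k} remG eff-l remH eff-k with l ≟ k
... | yes l≡k = l≡k
... | no  l≢k = ⊥-elim (<-asym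
      (gap<effective eff-k (removal-gap remH (removal-removed∈gaps remG) l≢k))
      (gap<effective eff-l (removal-gap remG (removal-removed∈gaps remH) (l≢k ∘ sym))))

removal-parent-⊆ : ∀ {G′ G H l} → Removal G′ G l → Removal G′ H l → IsEffectiveGenerator G l → G ⊆ H
removal-parent-⊆ remG remH eff-l n∈G =
  removal-gap remH (removal-gaps⊆ remG n∈G) (λ { refl → proj₁ (proj₁ eff-l) n∈G })

descends-parent-unique : ∀ {G′ G H} → Descends G′ G → Descends G′ H → G ≡ H
descends-parent-unique (isNSG , _ , l , eff-l , remG) (isNSH , _ , k , eff-k , remH)
  with refl ← removal-generator-unique remG eff-l remH eff-k =
  strictlyIncreasing-⊆-antisym (Linked⇒AllPairs <-trans (proj₁ isNSG)) (Linked⇒AllPairs <-trans (proj₁ isNSH))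
    (removal-parent-⊆ remG remH eff-l) (removal-parent-⊆ remH remG eff-k)

stronglyDescended⇒¬weakDescent : ∀ {G′ G} → StronglyDescended G′ → ¬ WeakDescent G′ G
stronglyDescended⇒¬weakDescent (inj₁ refl) ((_ , _ , _ , _ , removal) , _)
  with () ← removal-removed∈gaps removal
stronglyDescended⇒¬weakDescent (inj₂ (_ , descent , notWeak)) (descent′ , weak)
  with refl ← descends-parent-unique descent descent′ = notWeak weak

-- Reversing the chain walks from the descendent upwards, where each step is forced.
weakDescendent-root-unique : ∀ {G H X} → StronglyDescended G → StronglyDescended H →
                             WeakDescendent X G → WeakDescendent X H → G ≡ H
weakDescendent-root-unique sdG sdH wG wH = go sdG sdH (Star.reverse id wG) (Star.reverse id wH)
  where
  go : ∀ {G H X} → StronglyDescended G → StronglyDescended H →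
       Star WeakDescent X G → Star WeakDescent X H → G ≡ H
  go _   _   ε        ε          = refl
  go sdG _   ε        (w ◅ _)    = ⊥-elim (stronglyDescended⇒¬weakDescent sdG w)
  go _   sdH (w ◅ _)  ε          = ⊥-elim (stronglyDescended⇒¬weakDescent sdH w)
  go sdG sdH (w ◅ ws) (w′ ◅ ws′) with refl ← descends-parent-unique (proj₁ w) (proj₁ w′) =
    go sdG sdH ws ws′

record DescendentBounds (G X : Gaps) : Set where
  field
    isNumSemigroup : IsNumSemigroup X
    gaps⊆          : G ⊆ X
    gaps⊆gaps⊎eff  : ∀ {n} → n ∈ X → n ∈ G ⊎ IsEffectiveGenerator G n
    eff⊆eff        : ∀ {x} → IsEffectiveGenerator X x → IsEffectiveGenerator G x

weakDescendent⇒bounds : ∀ {G X} → IsNumSemigroup G → WeakDescendent X G → DescendentBounds G X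
weakDescendent⇒bounds {G} isNSG = go (record
  { isNumSemigroup = isNSG ; gaps⊆ = id ; gaps⊆gaps⊎eff = inj₁ ; eff⊆eff = id })
  where
  step : ∀ {Y Z} → DescendentBounds G Y → WeakDescent Z Y → DescendentBounds G Z
  step {Y} {Z} bY ((_ , isNSZ , l , eff-l , removal) , weak) = record
    { isNumSemigroup = isNSZ
    ; gaps⊆          = removal-gaps⊆ removal ∘ gaps⊆
    ; gaps⊆gaps⊎eff  = gaps⊆gaps⊎eff′
    ; eff⊆eff        = eff⊆eff ∘ weak _
    }
    where
    open DescendentBounds bY
    gaps⊆gaps⊎eff′ : ∀ {n} → n ∈ Z → n ∈ G ⊎ IsEffectiveGenerator G n
    gaps⊆gaps⊎eff′ {n} n∈Z with n ≟ l
    ... | yes refl = inj₂ (eff⊆eff eff-l)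
    ... | no  n≢l  = gaps⊆gaps⊎eff (removal-gap removal n∈Z n≢l)
  go : ∀ {Y Z} → DescendentBounds G Y → Star (λ A B → WeakDescent B A) Y Z → DescendentBounds G Z
  go bY ε        = bY
  go bY (w ◅ ws) = go (step bY w) ws

genus≤genus+h : ∀ {G X h} → DescendentBounds G X → IsH G h → genus X ≤ genus G + h
genus≤genus+h {G} {X} bounds (E , _ , E⇔eff , refl) =
  subst (genus X ≤_) (length-++ G)
    (injectiveOn⇒length≤ id (strictlyIncreasing⇒unique (proj₁ isNumSemigroup)) (λ _ _ → id) gaps⊆G++E)
  where
  open DescendentBounds bounds
  gaps⊆G++E : X ⊆ G ++ E
  gaps⊆G++E {n} n∈X with gaps⊆gaps⊎eff n∈X
  ... | inj₁ n∈G = ∈-++⁺ˡ n∈G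
  ... | inj₂ eff = ∈-++⁺ʳ G (from (E⇔eff n) eff)

g+3h≤3γ : ∀ γ g h → h + h ≤ γ → g ≤ γ + h → g + 3 * h ≤ 3 * γ
g+3h≤3γ γ g h 2h≤γ g≤γ+h = begin
  g + 3 * h                  ≤⟨ +-monoˡ-≤ (3 * h) g≤γ+h ⟩
  γ + h + 3 * h              ≡⟨ solve 2 (λ γ h → γ :+ h :+ con 3 :* h := γ :+ ((h :+ h) :+ (h :+ h))) refl γ h ⟩
  γ + ((h + h) + (h + h))    ≤⟨ +-monoʳ-≤ γ (+-mono-≤ 2h≤γ 2h≤γ) ⟩
  γ + (γ + γ)                ≡⟨ solve 1 (λ γ → γ :+ (γ :+ γ) := con 3 :* γ) refl γ ⟩
  3 * γ                      ∎
  where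
  open ≤-Reasoning
  open +-*-Solver

inS₂-gaps<2m : ∀ {g G X m} → InS₂ g G → IsMultiplicity G m → DescendentBounds G X → genus X ≡ g →
               ∀ {F} → F ∈ G → F < m + m
inS₂-gaps<2m {g} {G} {m = m} (isNSG , _ , h , isH , _ , 3γ<g+3h) mult bounds refl {F} F∈G with m + m ≤? F
... | no  2m≰F = ≰⇒> 2m≰F
... | yes 2m≤F = ⊥-elim (<-irrefl refl (<-≤-trans 3γ<g+3h
      (g+3h≤3γ (genus G) g h (twice-h≤genus isNSG mult isH F∈G 2m≤F) (genus≤genus+h bounds isH))))

descendent-multiplicity≥ : ∀ {G X m m′} → DescendentBounds G X → IsMultiplicity G m → IsMultiplicity X m′ →
                           m ≤ m′
descendent-multiplicity≥ bounds (_ , _ , least-m) (0<m′ , m′∉X , _) =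
  least-m _ 0<m′ (m′∉X ∘ DescendentBounds.gaps⊆ bounds)

descendent-gaps<3m : ∀ {G X m} → DescendentBounds G X → IsMultiplicity G m →
                     (∀ {F} → F ∈ G → F < m + m) → ∀ {a} → a ∈ X → a < 3 * m
descendent-gaps<3m {m = m} bounds mult gaps<2m {a} a∈X =
  subst (a <_) (cong (λ k → m + (m + k)) (sym (+-identityʳ m))) a<m+[m+m]
  where
  a<m+[m+m] : a < m + (m + m)
  a<m+[m+m] with DescendentBounds.gaps⊆gaps⊎eff bounds a∈X
  ... | inj₁ a∈G = <-≤-trans (gaps<2m a∈G) (m≤n+m (m + m) m)
  ... | inj₂ eff = minimal<multiplicity+gapBound mult (+-mono-< (proj₁ mult) (proj₁ mult)) gaps<2m (proj₁ eff)

s₂Pair⇒tSemigroup : ∀ {g G X} → S₂Pair g (G , X) → TSemigroup g X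
s₂Pair⇒tSemigroup {G = G} {X} (inS₂@(isNSG , _) , descendent , genusX≡g) =
  DescendentBounds.isNumSemigroup bounds , genusX≡g , m′ , mult′ ,
  frob<-gaps< X (λ a∈X → <-≤-trans (descendent-gaps<3m bounds mult gaps<2m a∈X) 3m≤3m′)
  where
  bounds : DescendentBounds G X
  bounds = weakDescendent⇒bounds isNSG descendent
  m m′ : ℕ
  m  = proj₁ (multiplicity G)
  m′ = proj₁ (multiplicity X)
  mult : IsMultiplicity G m
  mult = proj₂ (multiplicity G)
  mult′ : IsMultiplicity X m′
  mult′ = proj₂ (multiplicity X)
  gaps<2m : ∀ {F} → F ∈ G → F < m + m
  gaps<2m = inS₂-gaps<2m inS₂ mult bounds genusX≡g
  3m≤3m′ : 3 * m ≤ 3 * m′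
  3m≤3m′ = *-monoʳ-≤ 3 (descendent-multiplicity≥ bounds mult mult′)

corollary3 : (g n t : ℕ) → IsCount (S₂Pair g) n → IsCount (TSemigroup g) t → n ≤ t
corollary3 g n t (pairs , uniquePairs , pairs⇔ , refl) (ts , _ , ts⇔ , refl) =
  injectiveOn⇒length≤ proj₂ uniquePairs sameRoot descendent∈ts
  where
  descendent∈ts : ∀ {p} → p ∈ pairs → proj₂ p ∈ ts
  descendent∈ts {G , X} p∈ = from (ts⇔ X) (s₂Pair⇒tSemigroup (to (pairs⇔ (G , X)) p∈))
  sameRoot : ∀ {p q} → p ∈ pairs → q ∈ pairs → proj₂ p ≡ proj₂ q → p ≡ q
  sameRoot {G , X} {H , .X} p∈ q∈ refl
    with (_ , sdG , _) , wG , _ ← to (pairs⇔ (G , X)) p∈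
       | (_ , sdH , _) , wH , _ ← to (pairs⇔ (H , X)) q∈
    = cong (_, X) (weakDescendent-root-unique sdG sdH wG wH)
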